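{- Let $G \in \operatorname{cl}(P_3)$ have at least $7$ vertices, and let $U \subseteq V(G)$. If the switching $G^U$ also belongs to $\operatorname{cl}(P_3)$, then $U = \varnothing$ or $U = V(G)$.
   Context: All graphs are finite and simple; "subgraph" always means induced subgraph. $P_3$ denotes the cherry graph, the path with three vertices and two edges. For a family $\mathcal{G}$ of graphs, the closure $\operatorname{cl}(\mathcal{G})$ is the smallest class of graphs containing $\mathcal{G}$ that is closed under taking (induced) subgraphs and vertex-disjoint unions. For $U \subseteq V(G)$, the switching $G^U$ is the graph obtained from $G$ by toggling adjacency between every vertex of $U$ and every vertex of $V(G)\setminus U$. -}

module Defs where

open import Data.Nat using (ℕ; _+_)
open import Data.Fin using (Fin; zero; suc; splitAt)
open import Data.Fin.Subset using (Subset)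
open import Data.Vec using (lookup)
open import Data.Bool using (Bool; true; false; not; _xor_)
open import Data.Sum using (_⊎_; inj₁; inj₂)
open import Function.Definitions using (Injective)
open import Relation.Binary.PropositionalEquality using (_≡_; refl; cong₂; trans)

record Graph (n : ℕ) : Set where
  field
    adj    : Fin n → Fin n → Bool
    sym    : ∀ x y → adj x y ≡ adj y x
    irrefl : ∀ x → adj x x ≡ false
open Graph public

record _↪_ {m n : ℕ} (H : Graph m) (G : Graph n) : Set where
  field
    emb     : Fin m → Fin n
    emb-inj : Injective _≡_ _≡_ emb
    emb-adj : ∀ x y → adj H x y ≡ adj G (emb x) (emb y)

p3adj : Fin 3 → Fin 3 → Bool
p3adj zero (suc zero) = true
p3adj (suc zero) zero = true
p3adj (suc zero) (suc (suc zero)) = true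
p3adj (suc (suc zero)) (suc zero) = true
p3adj _ _ = false

p3sym : ∀ x y → p3adj x y ≡ p3adj y x
p3sym zero zero = refl
p3sym zero (suc zero) = refl
p3sym zero (suc (suc zero)) = refl
p3sym (suc zero) zero = refl
p3sym (suc zero) (suc zero) = refl
p3sym (suc zero) (suc (suc zero)) = refl
p3sym (suc (suc zero)) zero = refl
p3sym (suc (suc zero)) (suc zero) = refl
p3sym (suc (suc zero)) (suc (suc zero)) = refl

p3irr : ∀ x → p3adj x x ≡ false
p3irr zero = refl
p3irr (suc zero) = refl
p3irr (suc (suc zero)) = refl

P₃ : Graph 3
P₃ = record { adj = p3adj ; sym = p3sym ; irrefl = p3irr }

module _ {m n : ℕ} (G : Graph m) (H : Graph n) where
  uadj : Fin m ⊎ Fin n → Fin m ⊎ Fin n → Bool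
  uadj (inj₁ a) (inj₁ b) = adj G a b
  uadj (inj₂ a) (inj₂ b) = adj H a b
  uadj _ _ = false

  usym : ∀ x y → uadj x y ≡ uadj y x
  usym (inj₁ a) (inj₁ b) = sym G a b
  usym (inj₁ a) (inj₂ b) = refl
  usym (inj₂ a) (inj₁ b) = refl
  usym (inj₂ a) (inj₂ b) = sym H a b

  uirr : ∀ x → uadj x x ≡ false
  uirr (inj₁ a) = irrefl G a
  uirr (inj₂ a) = irrefl H a

  _⊕_ : Graph (m + n)
  _⊕_ = record
    { adj = λ x y → uadj (splitAt m x) (splitAt m y)
    ; sym = λ x y → usym (splitAt m x) (splitAt m y)
    ; irrefl = λ x → uirr (splitAt m x) }

data InCl : {n : ℕ} → Graph n → Set where
  base  : InCl P₃
  sub   : ∀ {m n} {G : Graph n} {H : Graph m} → InCl G → H ↪ G → InCl H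
  union : ∀ {m n} {G : Graph m} {H : Graph n} → InCl G → InCl H → InCl (G ⊕ H)

xor-comm' : ∀ a b → a xor b ≡ b xor a
xor-comm' true true = refl
xor-comm' true false = refl
xor-comm' false true = refl
xor-comm' false false = refl

xor-self : ∀ a → a xor a ≡ false
xor-self true = refl
xor-self false = refl

xor-false : ∀ a → a xor false ≡ a
xor-false true = refl
xor-false false = refl

switch : ∀ {n} → Graph n → Subset n → Graph n
switch {n} G U = record
  { adj = λ x y → adj G x y xor (lookup U x xor lookup U y)
  ; sym = λ x y → cong₂ _xor_ (sym G x y) (xor-comm' (lookup U x) (lookup U y))
  ; irrefl = λ x → trans (cong₂ _xor_ (irrefl G x) (xor-self (lookup U x))) refl }

-- Every graph in cl(P₃) has components with at most three vertices; all we use is that a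
-- path x − y − z is a whole component.  Hence in G and in Gᵁ every vertex has at most two
-- neighbours and two vertices have at most one common neighbour.  Every pair separated by
-- the cut (U, V ∖ U) is an edge of exactly one of G and Gᵁ, so each vertex has at most four
-- vertices on the other side, and with n ≥ 7 both sides have at least three vertices.  A
-- vertex a then has two neighbours b, b′ across the cut in one of the two graphs; the other
-- vertices on a's side are adjacent to both b and b′ in the other graph, so there is at most
-- one of them, a contradiction.
{-# OPTIONS --safe #-}
module Submission where

open import Defs renaming (sym to adj-sym; irrefl to adj-irrefl)
open import Data.Bool using (Bool; true; false; not)
open import Data.Bool.Properties using (not-involutive; xor-comm) renaming (_≟_ to _≟ᵇ_)
open import Data.Empty using (⊥-elim)
open import Data.Fin using (Fin; zero; suc; splitAt)
open import Data.Fin.Properties using (+↔⊎)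
open import Data.Fin.Subset using (Subset; ⊥; ⊤; ∁; Empty)
open import Data.Fin.Subset.Properties
  using (_∈?_; nonempty?; Empty-unique; ⊆-antisym; ⊆⊤; x∉p⇒x∈∁p; x∈∁p⇒x∉p)
open import Data.List using (List; []; _∷_; length; filter; allFin)
open import Data.List.Properties using (length-tabulate)
open import Data.List.Relation.Unary.All as All using (All; []; _∷_)
open import Data.List.Relation.Unary.All.Properties using (all-filter)
import Data.List.Relation.Unary.All.Properties as All
open import Data.List.Relation.Unary.Unique.Propositional using (Unique; []; _∷_)
import Data.List.Relation.Unary.Unique.Propositional.Properties as Unique
open import Data.Nat as ℕ using (ℕ; _≤_; _+_; z≤n; s≤s)
open import Data.Nat.Properties
  using (≤-trans; ≤-reflexive; n≤1+n; <⇒≱; +-suc; +-comm; +-mono-≤; +-monoˡ-≤; +-monoʳ-≤; +-cancelˡ-≤;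
         module ≤-Reasoning)
open import Data.Product using (_×_; _,_; proj₁; proj₂)
open import Data.Sum using (_⊎_; inj₁; inj₂; [_,_])
open import Data.Vec using (lookup)
open import Data.Vec.Properties using ([]=⇒lookup; lookup⇒[]=)
open import Function using (_∘_; id)
open import Function.Bundles using (Injection)
open import Function.Definitions using (Injective)
open import Function.Properties.Inverse using (↔⇒↣)
open import Relation.Binary.PropositionalEquality
  using (_≡_; _≢_; refl; sym; trans; cong; ≢-sym; module ≡-Reasoning)
open import Relation.Nullary using (yes; no; contradiction)
open import Relation.Nullary.Decidable using (decidable-stable; toSum)
open import Relation.Unary using (Pred; Decidable; _∪_)
open import Relation.Unary.Properties using (∁?)
open import Level using (Level)

private
  variable
    n : ℕ

true≢false : ∀ {b} → b ≡ true → b ≢ false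
true≢false refl ()

adj⇒≢ : (G : Graph n) {x y : Fin n} → adj G x y ≡ true → x ≢ y
adj⇒≢ G {x} xy refl = true≢false xy (adj-irrefl G x)

adjacent-sym : (G : Graph n) {x y : Fin n} → adj G x y ≡ true → adj G y x ≡ true
adjacent-sym G {x} {y} xy = trans (adj-sym G y x) xy

-- Components with at most three vertices, phrased locally: every path x − y − z is a whole
-- component (for symmetric k, excluding neighbours of y and z also excludes those of x).
SmallComponents : {V : Set} → (V → V → Bool) → Set
SmallComponents k = ∀ {x y z w} → x ≢ z → w ≢ x → w ≢ y → w ≢ z →
                    k x y ≡ true → k y z ≡ true → k w y ≡ false × k w z ≡ false

smallComponents-pullback : {A B : Set} {k : B → B → Bool} {k′ : A → A → Bool} (f : A → B) →
                           Injective _≡_ _≡_ f → (∀ x y → k′ x y ≡ k (f x) (f y)) →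
                           SmallComponents k → SmallComponents k′
smallComponents-pullback f f-inj k′≡k small {x} {y} {z} {w} x≢z w≢x w≢y w≢z xy yz =
  let wy , wz = small (x≢z ∘ f-inj) (w≢x ∘ f-inj) (w≢y ∘ f-inj) (w≢z ∘ f-inj)
                      (trans (sym (k′≡k x y)) xy) (trans (sym (k′≡k y z)) yz)
  in trans (k′≡k w y) wy , trans (k′≡k w z) wz

Fin3-covered : (w : Fin 3) → w ≢ zero → w ≢ suc zero → w ≢ suc (suc zero) → Data.Empty.⊥
Fin3-covered zero             w≢0 _   _   = w≢0 refl
Fin3-covered (suc zero)       _   w≢1 _   = w≢1 refl
Fin3-covered (suc (suc zero)) _   _   w≢2 = w≢2 refl

smallComponents-P₃ : SmallComponents p3adj
smallComponents-P₃ {zero}           {suc zero} {suc (suc zero)} {w} _ w≢x w≢y w≢z _ _ =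
  ⊥-elim (Fin3-covered w w≢x w≢y w≢z)
smallComponents-P₃ {suc (suc zero)} {suc zero} {zero}           {w} _ w≢x w≢y w≢z _ _ =
  ⊥-elim (Fin3-covered w w≢z w≢y w≢x)
smallComponents-P₃ {zero}           {suc zero}       {zero}           x≢z _ _ _ _ _ = ⊥-elim (x≢z refl)
smallComponents-P₃ {suc (suc zero)} {suc zero}       {suc (suc zero)} x≢z _ _ _ _ _ = ⊥-elim (x≢z refl)
smallComponents-P₃ {suc zero}       {zero}           {suc zero}       x≢z _ _ _ _ _ = ⊥-elim (x≢z refl)
smallComponents-P₃ {suc zero}       {suc (suc zero)} {suc zero}       x≢z _ _ _ _ _ = ⊥-elim (x≢z refl)

smallComponents-⊎ : ∀ {m n} (G : Graph m) (H : Graph n) →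
                    SmallComponents (adj G) → SmallComponents (adj H) → SmallComponents (uadj G H)
smallComponents-⊎ G H G-small H-small {inj₁ x} {inj₁ y} {inj₁ z} {inj₁ w} x≢z w≢x w≢y w≢z =
  G-small (x≢z ∘ cong inj₁) (w≢x ∘ cong inj₁) (w≢y ∘ cong inj₁) (w≢z ∘ cong inj₁)
smallComponents-⊎ G H G-small H-small {inj₂ x} {inj₂ y} {inj₂ z} {inj₂ w} x≢z w≢x w≢y w≢z =
  H-small (x≢z ∘ cong inj₂) (w≢x ∘ cong inj₂) (w≢y ∘ cong inj₂) (w≢z ∘ cong inj₂)
smallComponents-⊎ G H _ _ {inj₁ _} {inj₁ _} {inj₁ _} {inj₂ _} _ _ _ _ _ _ = refl , refl
smallComponents-⊎ G H _ _ {inj₂ _} {inj₂ _} {inj₂ _} {inj₁ _} _ _ _ _ _ _ = refl , refl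
smallComponents-⊎ G H _ _ {inj₁ _} {inj₂ _} _ _ _ _ ()
smallComponents-⊎ G H _ _ {inj₂ _} {inj₁ _} _ _ _ _ ()
smallComponents-⊎ G H _ _ {inj₁ _} {inj₁ _} {inj₂ _} _ _ _ _ _ ()
smallComponents-⊎ G H _ _ {inj₂ _} {inj₂ _} {inj₁ _} _ _ _ _ _ ()

InCl⇒smallComponents : {G : Graph n} → InCl G → SmallComponents (adj G)
InCl⇒smallComponents base = smallComponents-P₃
InCl⇒smallComponents (sub G∈cl H↪G) =
  smallComponents-pullback (emb H↪G) (emb-inj H↪G) (emb-adj H↪G) (InCl⇒smallComponents G∈cl)
  where open _↪_
InCl⇒smallComponents (union {m} {n} {G} {H} G∈cl H∈cl) =
  smallComponents-pullback (splitAt m) (Injection.injective (↔⇒↣ (+↔⊎ {m} {n}))) (λ _ _ → refl)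
    (smallComponents-⊎ G H (InCl⇒smallComponents G∈cl) (InCl⇒smallComponents H∈cl))

module _ {G : Graph n} (small : SmallComponents (adj G)) where

  -- A third neighbour of p would be adjacent to the middle of the path q₁ − p − q₂.
  neighbours-length≤2 : ∀ {p qs} → Unique qs → All (λ q → adj G p q ≡ true) qs → length qs ≤ 2
  neighbours-length≤2 {qs = []}              _ _ = z≤n
  neighbours-length≤2 {qs = _ ∷ []}          _ _ = s≤s z≤n
  neighbours-length≤2 {qs = _ ∷ _ ∷ []}      _ _ = s≤s (s≤s z≤n)
  neighbours-length≤2 {p} {q₁ ∷ q₂ ∷ q₃ ∷ _}
                      ((q₁≢q₂ ∷ q₁≢q₃ ∷ _) ∷ (q₂≢q₃ ∷ _) ∷ _) (pq₁ ∷ pq₂ ∷ pq₃ ∷ _) =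
    ⊥-elim (true≢false q₃p q₃p≡false)
    where
    q₃p : adj G q₃ p ≡ true
    q₃p = adjacent-sym G pq₃
    q₃p≡false : adj G q₃ p ≡ false
    q₃p≡false = proj₁ (small q₁≢q₂ (≢-sym q₁≢q₃) (adj⇒≢ G q₃p) (≢-sym q₂≢q₃) (adjacent-sym G pq₁) pq₂)

  -- Two common neighbours of b and b′ would make the path c₁ − b − c₂ − b′.
  commonNeighbours-length≤1 : ∀ {b b′ cs} → b ≢ b′ → Unique cs →
                              All (λ c → adj G c b ≡ true × adj G c b′ ≡ true) cs → length cs ≤ 1
  commonNeighbours-length≤1 {cs = []}          _ _ _ = z≤n
  commonNeighbours-length≤1 {cs = _ ∷ []}      _ _ _ = s≤s z≤n
  commonNeighbours-length≤1 {b} {b′} {c₁ ∷ c₂ ∷ _}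
                            b≢b′ ((c₁≢c₂ ∷ _) ∷ _) ((c₁b , c₁b′) ∷ (c₂b , c₂b′) ∷ _) =
    ⊥-elim (true≢false b′c₂ b′c₂≡false)
    where
    b′c₁ : adj G b′ c₁ ≡ true
    b′c₁ = adjacent-sym G c₁b′
    b′c₂ : adj G b′ c₂ ≡ true
    b′c₂ = adjacent-sym G c₂b′
    b′c₂≡false : adj G b′ c₂ ≡ false
    b′c₂≡false = proj₂ (small c₁≢c₂ (adj⇒≢ G b′c₁) (≢-sym b≢b′) (adj⇒≢ G b′c₂) c₁b (adjacent-sym G c₂b))

length≤filter+filter : {A : Set} {p q : Level} {P : Pred A p} {Q : Pred A q}
                       (P? : Decidable P) (Q? : Decidable Q) → ∀ {xs} → All (P ∪ Q) xs →
                       length xs ≤ length (filter P? xs) + length (filter Q? xs)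
length≤filter+filter P? Q? [] = z≤n
length≤filter+filter P? Q? {x ∷ xs} (Px⊎Qx ∷ P∪Q-xs)
  with ih ← length≤filter+filter P? Q? P∪Q-xs | P? x | Q? x
... | yes _  | yes _  = s≤s (≤-trans ih (+-monoʳ-≤ _ (n≤1+n _)))
... | yes _  | no _   = s≤s ih
... | no _   | yes _  = ≤-trans (s≤s ih) (≤-reflexive (sym (+-suc _ _)))
... | no ¬Px | no ¬Qx = contradiction Px⊎Qx [ ¬Px , ¬Qx ]

3≤m+n⇒2≤m⊎2≤n : ∀ m {n} → 3 ≤ m + n → 2 ≤ m ⊎ 2 ≤ n
3≤m+n⇒2≤m⊎2≤n (ℕ.suc (ℕ.suc _)) _         = inj₁ (s≤s (s≤s z≤n))
3≤m+n⇒2≤m⊎2≤n 1                   (s≤s 2≤n) = inj₂ 2≤n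
3≤m+n⇒2≤m⊎2≤n 0                   3≤n       = inj₂ (≤-trans (n≤1+n 2) 3≤n)

7≤m+n⇒3≤m : ∀ {m n} → n ≤ 4 → 7 ≤ m + n → 3 ≤ m
7≤m+n⇒3≤m {m} {n} n≤4 7≤m+n = +-cancelˡ-≤ 4 _ _ (begin
  7      ≤⟨ 7≤m+n ⟩
  m + n  ≡⟨ +-comm m n ⟩
  n + m  ≤⟨ +-monoˡ-≤ m n≤4 ⟩
  4 + m  ∎)
  where open ≤-Reasoning

neighboursIn : Graph n → Fin n → List (Fin n) → List (Fin n)
neighboursIn G a = filter (λ b → adj G a b ≟ᵇ true)

ComplementaryAcross : (Fin n → Bool) → Graph n → Graph n → Set
ComplementaryAcross s G H = ∀ {x y} → s x ≢ s y → adj H x y ≡ not (adj G x y)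

switch-complementary : (G : Graph n) (U : Subset n) → ComplementaryAcross (lookup U) G (switch G U)
switch-complementary G U {x} {y} Ux≢Uy with lookup U x | lookup U y
... | true  | false = xor-comm (adj G x y) true
... | false | true  = xor-comm (adj G x y) true
... | true  | true  = contradiction refl Ux≢Uy
... | false | false = contradiction refl Ux≢Uy

module _ {s : Fin n → Bool} where

  opposite-sides : ∀ {σ x y} → s x ≡ σ → s y ≢ σ → s x ≢ s y
  opposite-sides sx≡σ sy≢σ sx≡sy = sy≢σ (trans (sym sx≡sy) sx≡σ)

  complementary-sym : {G H : Graph n} → ComplementaryAcross s G H → ComplementaryAcross s H G
  complementary-sym G⇄H sx≢sy = sym (trans (cong not (G⇄H sx≢sy)) (not-involutive _))

  adjacent-on-one-side : {G H : Graph n} → ComplementaryAcross s G H →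
                         ∀ {x y} → s x ≢ s y → adj G x y ≡ true ⊎ adj H x y ≡ true
  adjacent-on-one-side {G} G⇄H {x} {y} sx≢sy with adj G x y | G⇄H sx≢sy
  ... | true  | _        = inj₁ refl
  ... | false | Hxy≡true = inj₂ Hxy≡true

  -- b′ − a − b is a component of X, so every c ≢ a on the far side of the cut from b and b′
  -- is X′-adjacent to both; two such c would be two common neighbours of b and b′ in X′.
  cherry-bounds-side : {X X′ : Graph n} → SmallComponents (adj X) → SmallComponents (adj X′) →
                       ComplementaryAcross s X X′ → ∀ {σ a ys cs} →
                       Unique ys → All (λ y → adj X a y ≡ true) ys → All (λ y → s y ≢ σ) ys → 2 ≤ length ys →
                       Unique cs → All (a ≢_) cs → All (λ c → s c ≡ σ) cs → length cs ≤ 1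
  cherry-bounds-side _ _ _ {ys = []}     _ _ _ ()
  cherry-bounds-side _ _ _ {ys = _ ∷ []} _ _ _ (s≤s ())
  cherry-bounds-side {X} {X′} X-small X′-small X⇄X′ {σ} {a} {b ∷ b′ ∷ _}
                     ((b≢b′ ∷ _) ∷ _) (ab ∷ ab′ ∷ _) (sb ∷ sb′ ∷ _) _ cs! a≢cs s-cs =
    commonNeighbours-length≤1 {G = X′} X′-small b≢b′ cs!
      (All.zipWith (λ (a≢c , sc) → X′-adjacent b≢b′ ab ab′ sb sb′ a≢c sc
                                  , X′-adjacent (≢-sym b≢b′) ab′ ab sb′ sb a≢c sc)
                   (a≢cs , s-cs))
    where
    X′-adjacent : ∀ {c d d′} → d ≢ d′ → adj X a d ≡ true → adj X a d′ ≡ true → s d ≢ σ → s d′ ≢ σ →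
                  a ≢ c → s c ≡ σ → adj X′ c d ≡ true
    X′-adjacent {c} {d} {d′} d≢d′ ad ad′ sd sd′ a≢c sc = begin
      adj X′ c d        ≡⟨ X⇄X′ (opposite-sides sc sd) ⟩
      not (adj X c d)   ≡⟨ cong not (proj₂ (X-small (≢-sym d≢d′) c≢d′ (≢-sym a≢c) c≢d d′a ad)) ⟩
      true              ∎
      where
      open ≡-Reasoning
      c≢d : c ≢ d
      c≢d = opposite-sides sc sd ∘ cong s
      c≢d′ : c ≢ d′
      c≢d′ = opposite-sides sc sd′ ∘ cong s
      d′a : adj X d′ a ≡ true
      d′a = adjacent-sym X ad′

  module _ {G H : Graph n} (G-small : SmallComponents (adj G)) (H-small : SmallComponents (adj H))
           (G⇄H : ComplementaryAcross s G H) where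

    split-by-adjacency : ∀ {a bs} → All (λ b → s a ≢ s b) bs →
                         length bs ≤ length (neighboursIn G a bs) + length (neighboursIn H a bs)
    split-by-adjacency {a} =
      length≤filter+filter _ _ ∘ All.map (adjacent-on-one-side {G} {H} G⇄H)

    across-length≤4 : ∀ {a bs} → Unique bs → All (λ b → s a ≢ s b) bs → length bs ≤ 4
    across-length≤4 {a} {bs} bs! a∣bs = begin
      length bs                                                ≤⟨ split-by-adjacency a∣bs ⟩
      length (neighboursIn G a bs) + length (neighboursIn H a bs) ≤⟨ +-mono-≤ G-bound H-bound ⟩
      2 + 2                                                    ∎
      where
      open ≤-Reasoning
      G-bound : length (neighboursIn G a bs) ≤ 2
      G-bound = neighbours-length≤2 {G = G} G-small (Unique.filter⁺ _ bs!) (all-filter _ bs)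
      H-bound : length (neighboursIn H a bs) ≤ 2
      H-bound = neighbours-length≤2 {G = H} H-small (Unique.filter⁺ _ bs!) (all-filter _ bs)

    -- By pigeonhole a has two neighbours across the cut in G or in H, which leaves room for at
    -- most one further vertex on a's side.
    no-K₃,₃ : ∀ {σ as bs} → Unique as → All (λ c → s c ≡ σ) as → Unique bs → All (λ b → s b ≢ σ) bs →
              3 ≤ length as → 3 ≤ length bs → Data.Empty.⊥
    no-K₃,₃ {as = a ∷ cs} {bs} (a≢cs ∷ cs!) (sa ∷ s-cs) bs! s-bs (s≤s 2≤cs) 3≤bs
      with 3≤m+n⇒2≤m⊎2≤n _ (≤-trans 3≤bs (split-by-adjacency (All.map (opposite-sides sa) s-bs)))
    ... | inj₁ 2≤G = <⇒≱ 2≤cs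
      (cherry-bounds-side {G} {H} G-small H-small G⇄H
         (Unique.filter⁺ _ bs!) (all-filter _ bs) (All.filter⁺ _ s-bs) 2≤G cs! a≢cs s-cs)
    ... | inj₂ 2≤H = <⇒≱ 2≤cs
      (cherry-bounds-side {H} {G} H-small G-small (complementary-sym {G} {H} G⇄H)
         (Unique.filter⁺ _ bs!) (all-filter _ bs) (All.filter⁺ _ s-bs) 2≤H cs! a≢cs s-cs)

    no-proper-cut : 7 ≤ n → ∀ {u w} → s u ≡ true → s w ≢ true → Data.Empty.⊥
    no-proper-cut 7≤n {u} {w} su sw =
      no-K₃,₃ (Unique.filter⁺ inside? all!) (all-filter inside? (allFin n))
              (Unique.filter⁺ outside? all!) (all-filter outside? (allFin n))
              (7≤m+n⇒3≤m B≤4 7≤A+B) (7≤m+n⇒3≤m A≤4 7≤B+A)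
      where
      inside? : Decidable (λ x → s x ≡ true)
      inside? x = s x ≟ᵇ true
      outside? : Decidable (λ x → s x ≢ true)
      outside? = ∁? inside?
      all! : Unique (allFin n)
      all! = Unique.allFin⁺ n
      A B : List (Fin n)
      A = filter inside? (allFin n)
      B = filter outside? (allFin n)
      7≤A+B : 7 ≤ length A + length B
      7≤A+B = begin
        7                    ≤⟨ 7≤n ⟩
        n                    ≡⟨ length-tabulate id ⟨
        length (allFin n)    ≤⟨ length≤filter+filter inside? outside? (All.universal (toSum ∘ inside?) (allFin n)) ⟩
        length A + length B  ∎
        where open ≤-Reasoning
      7≤B+A : 7 ≤ length B + length A
      7≤B+A = ≤-trans 7≤A+B (≤-reflexive (+-comm (length A) (length B)))
      A≤4 : length A ≤ 4
      A≤4 = across-length≤4 (Unique.filter⁺ inside? all!)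
                            (All.map (λ sa → ≢-sym (opposite-sides sa sw)) (all-filter inside? (allFin n)))
      B≤4 : length B ≤ 4
      B≤4 = across-length≤4 (Unique.filter⁺ outside? all!)
                            (All.map (opposite-sides su) (all-filter outside? (allFin n)))

Empty-∁⇒≡⊤ : {p : Subset n} → Empty (∁ p) → p ≡ ⊤
Empty-∁⇒≡⊤ {p = p} ∁p-empty =
  ⊆-antisym ⊆⊤ (λ {x} _ → decidable-stable (x ∈? p) (λ x∉p → ∁p-empty (x , x∉p⇒x∈∁p x∉p)))

proposition3p2 : ∀ {n : ℕ} (G : Graph n) (U : Subset n) → 7 ≤ n → InCl G →
                   InCl (switch G U) → U ≡ ⊥ ⊎ U ≡ ⊤
proposition3p2 G U 7≤n G∈cl Gᵁ∈cl with nonempty? U | nonempty? (∁ U)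
... | no U-empty    | _              = inj₁ (Empty-unique U-empty)
... | yes _         | no ∁U-empty    = inj₂ (Empty-∁⇒≡⊤ ∁U-empty)
... | yes (u , u∈U) | yes (w , w∈∁U) =
  ⊥-elim (no-proper-cut {s = lookup U} {G} {switch G U}
            (InCl⇒smallComponents G∈cl) (InCl⇒smallComponents Gᵁ∈cl) (switch-complementary G U)
            7≤n ([]=⇒lookup u∈U) (x∈∁p⇒x∉p w∈∁U ∘ lookup⇒[]= w U))
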